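{- Greedy sandpile on $\mathbb Z^2$: place $n$ grains of sand at the origin and none elsewhere; repeatedly choose any site holding at least $5$ grains and move $4$ of its grains, one to each of its four neighbours, until every site holds at most $4$ grains. Rotor-router aggregation on $\mathbb Z^2$: bugs are added at the origin one at a time; a bug at an unoccupied site occupies it permanently and sets its rotor pointing East; a bug at an occupied site turns that site's rotor a quarter turn counterclockwise (cycling North, West, South, East) and steps to the neighbour the rotor now points to; the next bug is added once the previous one has occupied a site. Then every site that holds at least one grain in the final stable greedy sandpile configuration is occupied after $n$ bugs have been added in the rotor-router aggregation. -}

module Defs where

open import Data.Nat using (ℕ; zero; suc; _+_; _∸_; _≤_)
open import Data.Integer as ℤ using (ℤ; +_; -[1+_])
open import Data.Product using (_×_; _,_)
open import Data.Product.Properties using (≡-dec)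
open import Data.Maybe using (Maybe; just; nothing)
open import Relation.Nullary using (yes; no)
open import Relation.Binary using (DecidableEquality)
open import Relation.Binary.PropositionalEquality using (_≡_)
open import Relation.Binary.Construct.Closure.ReflexiveTransitive using (Star)

Site : Set
Site = ℤ × ℤ

origin : Site
origin = (+ 0 , + 0)

_≟ₛ_ : DecidableEquality Site
_≟ₛ_ = ≡-dec ℤ._≟_ ℤ._≟_

data Dir : Set where
  East North West South : Dir

stepIn : Dir → Site → Site
stepIn East  (a , b) = (a ℤ.+ ℤ.1ℤ , b)
stepIn North (a , b) = (a , b ℤ.+ ℤ.1ℤ)
stepIn West  (a , b) = (a ℤ.- ℤ.1ℤ , b)
stepIn South (a , b) = (a , b ℤ.- ℤ.1ℤ)

Config : Set
Config = Site → ℕ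

initial : ℕ → Config
initial n y with y ≟ₛ origin
... | yes _ = n
... | no  _ = 0

δ : Site → Site → ℕ
δ y z with y ≟ₛ z
... | yes _ = 1
... | no  _ = 0

fire : Site → Config → Config
fire x η y = base + δ y (stepIn East x) + δ y (stepIn North x)
                  + δ y (stepIn West x) + δ y (stepIn South x)
  where
  base : ℕ
  base with y ≟ₛ x
  ... | yes _ = η y ∸ 4
  ... | no  _ = η y

data Topple : Config → Config → Set where
  topple : ∀ (η : Config) (x : Site) → 5 ≤ η x → Topple η (fire x η)

Stable : Config → Set
Stable η = ∀ (y : Site) → η y ≤ 4

-- nothing = unoccupied; just d = occupied with rotor pointing in direction d
RotorState : Set
RotorState = Site → Maybe Dir

emptyState : RotorState
emptyState _ = nothing

turn : Dir → Dir
turn East  = North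
turn North = West
turn West  = South
turn South = East

update : Site → Maybe Dir → RotorState → RotorState
update x v σ y with y ≟ₛ x
... | yes _ = v
... | no  _ = σ y

data Walk : RotorState → Site → RotorState → Set where
  settle : ∀ {σ x} → σ x ≡ nothing → Walk σ x (update x (just East) σ)
  move   : ∀ {σ x d σ'} → σ x ≡ just d →
           Walk (update x (just (turn d)) σ) (stepIn (turn d) x) σ' →
           Walk σ x σ'

data Aggregation : ℕ → RotorState → Set where
  agg-zero : Aggregation 0 emptyState
  agg-suc  : ∀ {n σ σ'} → Aggregation n σ → Walk σ origin σ' → Aggregation (suc n) σ'

Occupied : RotorState → Site → Set
Occupied σ x = Data.Product.∃ λ (d : Dir) → σ x ≡ just d

{-# OPTIONS --safe #-}
-- The proof compares the two processes through their odometers. In the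
-- rotor-router aggregation let R y count the bugs that have passed through or
-- settled at y and E y d the bugs sent from y in direction d. Bugs are
-- conserved, R = initial n + (inflow of E), and a rotor serves its four
-- directions in turn, so R y ≤ 4 + 4 E y d at every site. For the
-- sandpile let t y count the topplings at y; then η + 4 t = initial n + (inflow
-- of t). Along the topplings t y ≤ E y d is preserved: a site x may topple only
-- with at least 5 grains, and 5 + 4 t x ≤ η x + 4 t x ≤ R x ≤ 4 + 4 E x d.
-- Hence η ≤ R, and a site holding a grain has been visited, so it is occupied.
module Submission where

open import Defs
open import Data.Nat using (ℕ; suc; _+_; _*_; _∸_; _≤_; z≤n; s≤s; s≤s⁻¹)
open import Data.Nat.Properties
open import Data.Nat.Tactic.RingSolver using (solve-∀)
import Data.Integer as ℤ
import Data.Integer.Properties as ℤₚ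
open import Algebra.Properties.AbelianGroup ℤₚ.+-0-abelianGroup
  using (//-rightDividesˡ; //-rightDividesʳ)
open import Algebra.Properties.CommutativeSemigroup +-commutativeSemigroup
  using (x∙yz≈y∙xz)
open import Data.Product using (∃; _×_; _,_)
open import Data.Maybe using (Maybe; just; nothing)
open import Relation.Nullary using (yes; no; contradiction)
open import Relation.Binary.PropositionalEquality
open import Relation.Binary.Construct.Closure.ReflexiveTransitive using (Star; ε; _◅_)

opposite : Dir → Dir
opposite East  = West
opposite North = South
opposite West  = East
opposite South = North

stepIn-opposite-stepIn : ∀ d z → stepIn (opposite d) (stepIn d z) ≡ z
stepIn-opposite-stepIn East  (a , b) = cong (_, b) (//-rightDividesʳ ℤ.1ℤ a)
stepIn-opposite-stepIn North (a , b) = cong (a ,_) (//-rightDividesʳ ℤ.1ℤ b)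
stepIn-opposite-stepIn West  (a , b) = cong (_, b) (//-rightDividesˡ ℤ.1ℤ a)
stepIn-opposite-stepIn South (a , b) = cong (a ,_) (//-rightDividesˡ ℤ.1ℤ b)

stepIn-stepIn-opposite : ∀ d z → stepIn d (stepIn (opposite d) z) ≡ z
stepIn-stepIn-opposite East  (a , b) = cong (_, b) (//-rightDividesˡ ℤ.1ℤ a)
stepIn-stepIn-opposite North (a , b) = cong (a ,_) (//-rightDividesˡ ℤ.1ℤ b)
stepIn-stepIn-opposite West  (a , b) = cong (_, b) (//-rightDividesʳ ℤ.1ℤ a)
stepIn-stepIn-opposite South (a , b) = cong (a ,_) (//-rightDividesʳ ℤ.1ℤ b)

δ-cong-⇔ : ∀ {a b c e} → (a ≡ b → c ≡ e) → (c ≡ e → a ≡ b) → δ a b ≡ δ c e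
δ-cong-⇔ {a} {b} {c} {e} to from with a ≟ₛ b | c ≟ₛ e
... | yes _   | yes _   = refl
... | no _    | no _    = refl
... | yes a≡b | no c≢e  = contradiction (to a≡b) c≢e
... | no a≢b  | yes c≡e = contradiction (from c≡e) a≢b

δ-stepIn : ∀ d x y → δ (stepIn (opposite d) y) x ≡ δ y (stepIn d x)
δ-stepIn d x y = δ-cong-⇔
  (λ eq → trans (sym (stepIn-stepIn-opposite d y)) (cong (stepIn d) eq))
  (λ eq → trans (cong (stepIn (opposite d)) eq) (stepIn-opposite-stepIn d x))

sumDir : (Dir → ℕ) → ℕ
sumDir f = f East + f North + f West + f South

sumDir-cong : ∀ {f g} → (∀ d → f d ≡ g d) → sumDir f ≡ sumDir g
sumDir-cong f≗g =
  cong₂ _+_ (cong₂ _+_ (cong₂ _+_ (f≗g East) (f≗g North)) (f≗g West)) (f≗g South)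

sumDir-mono-≤ : ∀ {f g} → (∀ d → f d ≤ g d) → sumDir f ≤ sumDir g
sumDir-mono-≤ f≤g =
  +-mono-≤ (+-mono-≤ (+-mono-≤ (f≤g East) (f≤g North)) (f≤g West)) (f≤g South)

sumDir-+ : ∀ (f g : Dir → ℕ) → sumDir (λ d → f d + g d) ≡ sumDir f + sumDir g
sumDir-+ f g = lemma (f East) (f North) (f West) (f South) (g East) (g North) (g West) (g South)
  where
  lemma : ∀ a b c d a′ b′ c′ d′ →
          (a + a′) + (b + b′) + (c + c′) + (d + d′) ≡ (a + b + c + d) + (a′ + b′ + c′ + d′)
  lemma = solve-∀

sumDir-const : ∀ k → sumDir (λ _ → k) ≡ k * 4
sumDir-const k = lemma k
  where
  lemma : ∀ k → k + k + k + k ≡ k * 4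
  lemma = solve-∀

δᴰ : Dir → Dir → ℕ
δᴰ East  East  = 1
δᴰ North North = 1
δᴰ West  West  = 1
δᴰ South South = 1
δᴰ _     _     = 0

sumDir-δᴰ : ∀ e → sumDir (δᴰ e) ≡ 1
sumDir-δᴰ East  = refl
sumDir-δᴰ North = refl
sumDir-δᴰ West  = refl
sumDir-δᴰ South = refl

sumDir-sift : ∀ e (f : Dir → ℕ) → sumDir (λ d → δᴰ e d * f d) ≡ f e
sumDir-sift East  f = trans (+-identityʳ _) (trans (+-identityʳ _) (trans (+-identityʳ _) (+-identityʳ _)))
sumDir-sift North f = trans (+-identityʳ _) (trans (+-identityʳ _) (+-identityʳ _))
sumDir-sift West  f = trans (+-identityʳ _) (+-identityʳ _)
sumDir-sift South f = +-identityʳ _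

inflow : (Site → Dir → ℕ) → Site → ℕ
inflow E y = sumDir (λ d → E (stepIn (opposite d) y) d)

inflow-mono-≤ : ∀ {E F} → (∀ z d → E z d ≤ F z d) → ∀ y → inflow E y ≤ inflow F y
inflow-mono-≤ E≤F y = sumDir-mono-≤ (λ d → E≤F (stepIn (opposite d) y) d)

-- sent r d: the bugs a rotor now pointing at r has sent in direction d since
-- it last pointed East.
sent : Dir → Dir → ℕ
sent East  _     = 0
sent North North = 1
sent West  North = 1
sent West  West  = 1
sent South North = 1
sent South West  = 1
sent South South = 1
sent _     _     = 0

sumDir-sent≤3 : ∀ r → sumDir (sent r) ≤ 3
sumDir-sent≤3 East  = z≤n
sumDir-sent≤3 North = s≤s z≤n
sumDir-sent≤3 West  = s≤s (s≤s z≤n)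
sumDir-sent≤3 South = ≤-refl

completesRound : Dir → ℕ
completesRound South = 1
completesRound _     = 0

sent-turn : ∀ r q d → δᴰ (turn r) d + (sent r d + q) ≡ sent (turn r) d + (completesRound r + q)
sent-turn East  q = λ { East → refl ; North → refl ; West → refl ; South → refl }
sent-turn North q = λ { East → refl ; North → refl ; West → refl ; South → refl }
sent-turn West  q = λ { East → refl ; North → refl ; West → refl ; South → refl }
sent-turn South q = λ { East → refl ; North → refl ; West → refl ; South → refl }

-- Every visit but the settling one ends in an emission; q counts the
-- completed rounds of the rotor.
data RotorCount (R : ℕ) (E : Dir → ℕ) : Maybe Dir → Set where
  vacant   : R ≡ 0 → (∀ d → E d ≡ 0) → RotorCount R E nothing
  pointing : ∀ {r} q → R ≡ suc (sumDir E) → (∀ d → E d ≡ sent r d + q) →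
             RotorCount R E (just r)

settle-count : ∀ {R E} → RotorCount R E nothing → RotorCount (suc R) E (just East)
settle-count (vacant R≡0 E≗0) =
  pointing 0 (cong suc (trans R≡0 (sym (sumDir-cong E≗0)))) E≗0

turn-count : ∀ {R E E′ r} → RotorCount R E (just r) → (∀ d → E′ d ≡ δᴰ (turn r) d + E d) →
             RotorCount (suc R) E′ (just (turn r))
turn-count {R} {E} {E′} {r} (pointing q R≡ E≗) E′≗ =
  pointing (completesRound r + q) (cong suc (begin
      R                                      ≡⟨ R≡ ⟩
      1 + sumDir E                           ≡⟨ cong (_+ sumDir E) (sumDir-δᴰ (turn r)) ⟨
      sumDir (δᴰ (turn r)) + sumDir E        ≡⟨ sumDir-+ (δᴰ (turn r)) E ⟨
      sumDir (λ d → δᴰ (turn r) d + E d)     ≡⟨ sumDir-cong E′≗ ⟨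
      sumDir E′                              ∎))
    (λ d → trans (E′≗ d) (trans (cong (δᴰ (turn r) d +_) (E≗ d)) (sent-turn r q d)))
  where open ≡-Reasoning

-- A rotor serves its four directions in turn, so no direction lags by more
-- than one round.
visits≤emissions : ∀ {R E s} → RotorCount R E s → ∀ d → R ≤ 4 + E d * 4
visits≤emissions (vacant refl _) d = z≤n
visits≤emissions {R} {E} (pointing {r} q R≡ E≗) d = begin
  R                                        ≡⟨ R≡ ⟩
  suc (sumDir E)                           ≡⟨ cong suc (sumDir-cong E≗) ⟩
  suc (sumDir (λ d → sent r d + q))        ≡⟨ cong suc (sumDir-+ (sent r) (λ _ → q)) ⟩
  suc (sumDir (sent r) + sumDir (λ _ → q)) ≡⟨ cong (λ k → suc (sumDir (sent r) + k)) (sumDir-const q) ⟩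
  suc (sumDir (sent r) + q * 4)            ≤⟨ s≤s (+-monoˡ-≤ (q * 4) (sumDir-sent≤3 r)) ⟩
  4 + q * 4                                ≤⟨ +-monoʳ-≤ 4 (*-monoˡ-≤ 4 q≤Ed) ⟩
  4 + E d * 4                              ∎
  where
  open ≤-Reasoning
  q≤Ed : q ≤ E d
  q≤Ed = subst (q ≤_) (sym (E≗ d)) (m≤n+m q (sent r d))

visited⇒occupied : ∀ {R E s} → RotorCount R E s → 1 ≤ R → ∃ λ d → s ≡ just d
visited⇒occupied (vacant refl _) ()
visited⇒occupied (pointing _ _ _) _ = _ , refl

Consistent : RotorState → (Site → ℕ) → (Site → Dir → ℕ) → Set
Consistent σ R E = ∀ y → RotorCount (R y) (E y) (σ y)

record RotorTally (s : Site → ℕ) (σ : RotorState) : Set where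
  field
    visits     : Site → ℕ
    emissions  : Site → Dir → ℕ
    consistent : Consistent σ visits emissions
    conserved  : ∀ y → visits y ≡ s y + inflow emissions y

sendFrom : Site → Dir → (Site → Dir → ℕ) → Site → Dir → ℕ
sendFrom x e E z d = δ z x * δᴰ e d + E z d

inflow-sendFrom : ∀ x e E y → inflow (sendFrom x e E) y ≡ δ y (stepIn e x) + inflow E y
inflow-sendFrom x e E y = begin
  inflow (sendFrom x e E) y
    ≡⟨ sumDir-+ (λ d → δ (stepIn (opposite d) y) x * δᴰ e d) (λ d → E (stepIn (opposite d) y) d) ⟩
  sumDir (λ d → δ (stepIn (opposite d) y) x * δᴰ e d) + inflow E y
    ≡⟨ cong (_+ inflow E y) (sumDir-cong λ d →
         trans (cong (_* δᴰ e d) (δ-stepIn d x y)) (*-comm (δ y (stepIn d x)) (δᴰ e d))) ⟩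
  sumDir (λ d → δᴰ e d * δ y (stepIn d x)) + inflow E y
    ≡⟨ cong (_+ inflow E y) (sumDir-sift e (λ d → δ y (stepIn d x))) ⟩
  δ y (stepIn e x) + inflow E y
    ∎
  where open ≡-Reasoning

-- The bug walking at x is counted by δ · x but not yet by R.
walk-tally : ∀ {s σ x σ′ R E} → Walk σ x σ′ → Consistent σ R E →
             (∀ y → δ y x + R y ≡ s y + inflow E y) → RotorTally s σ′
walk-tally {σ = σ} {x} {R = R} {E} (settle σx≡nothing) consistent conserved = record
  { visits     = λ y → δ y x + R y
  ; emissions  = E
  ; consistent = consistent′
  ; conserved  = conserved
  }
  where
  consistent′ : Consistent (update x (just East) σ) (λ y → δ y x + R y) E
  consistent′ y with y ≟ₛ x
  ... | yes refl = settle-count (subst (RotorCount _ _) σx≡nothing (consistent x))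
  ... | no _     = consistent y
walk-tally {s = s} {σ} {x} {R = R} {E} (move {d = r} σx≡r w) consistent conserved =
  walk-tally w consistent′ conserved′
  where
  x′ = stepIn (turn r) x

  consistent′ : Consistent (update x (just (turn r)) σ) (λ y → δ y x + R y) (sendFrom x (turn r) E)
  consistent′ y with y ≟ₛ x
  ... | yes refl = turn-count (subst (RotorCount _ _) σx≡r (consistent x))
                     (λ d → cong (_+ E x d) (*-identityˡ (δᴰ (turn r) d)))
  ... | no _     = consistent y

  conserved′ : ∀ y → δ y x′ + (δ y x + R y) ≡ s y + inflow (sendFrom x (turn r) E) y
  conserved′ y = begin
    δ y x′ + (δ y x + R y)         ≡⟨ cong (δ y x′ +_) (conserved y) ⟩
    δ y x′ + (s y + inflow E y)    ≡⟨ x∙yz≈y∙xz (δ y x′) (s y) (inflow E y) ⟩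
    s y + (δ y x′ + inflow E y)    ≡⟨ cong (s y +_) (inflow-sendFrom x (turn r) E y) ⟨
    s y + inflow (sendFrom x (turn r) E) y ∎
    where open ≡-Reasoning

initial-zero : ∀ y → initial 0 y ≡ 0
initial-zero y with y ≟ₛ origin
... | yes _ = refl
... | no _  = refl

initial-suc : ∀ m y → initial (suc m) y ≡ δ y origin + initial m y
initial-suc m y with y ≟ₛ origin
... | yes _ = refl
... | no _  = refl

aggregation-tally : ∀ {n σ} → Aggregation n σ → RotorTally (initial n) σ
aggregation-tally agg-zero = record
  { visits     = λ _ → 0
  ; emissions  = λ _ _ → 0
  ; consistent = λ _ → vacant refl (λ _ → refl)
  ; conserved  = λ y → sym (trans (+-identityʳ (initial 0 y)) (initial-zero y))
  }
aggregation-tally {suc m} (agg-suc aggregation w) = walk-tally w consistent conserved′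
  where
  open RotorTally (aggregation-tally aggregation)
  conserved′ : ∀ y → δ y origin + visits y ≡ initial (suc m) y + inflow emissions y
  conserved′ y = begin
    δ y origin + visits y                          ≡⟨ cong (δ y origin +_) (conserved y) ⟩
    δ y origin + (initial m y + inflow emissions y) ≡⟨ +-assoc (δ y origin) _ _ ⟨
    δ y origin + initial m y + inflow emissions y   ≡⟨ cong (_+ inflow emissions y) (initial-suc m y) ⟨
    initial (suc m) y + inflow emissions y          ∎
    where open ≡-Reasoning

Odometer : (Site → ℕ) → Config → (Site → ℕ) → Set
Odometer s η t = ∀ y → η y + t y * 4 ≡ s y + inflow (λ z _ → t z) y

adjacent : Site → Site → ℕ
adjacent x y = sumDir (λ d → δ y (stepIn d x))

fire-conserves : ∀ x η → 4 ≤ η x → ∀ y → fire x η y + δ y x * 4 ≡ η y + adjacent x y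
fire-conserves x η 4≤ηx y with y ≟ₛ x
... | yes refl = trans (regroup (η x ∸ 4) _ _ _ _) (cong (_+ _) (m∸n+n≡m 4≤ηx))
  where
  regroup : ∀ m a b c d → m + a + b + c + d + 4 ≡ m + 4 + (a + b + c + d)
  regroup = solve-∀
... | no _     = regroup (η y) _ _ _ _
  where
  regroup : ∀ m a b c d → m + a + b + c + d + 0 ≡ m + (a + b + c + d)
  regroup = solve-∀

inflow-topple : ∀ x (t : Site → ℕ) y →
                inflow (λ z _ → δ z x + t z) y ≡ adjacent x y + inflow (λ z _ → t z) y
inflow-topple x t y =
  trans (sumDir-+ (λ d → δ (stepIn (opposite d) y) x) (λ d → t (stepIn (opposite d) y)))
        (cong (_+ inflow (λ z _ → t z) y) (sumDir-cong (λ d → δ-stepIn d x y)))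

fire-odometer : ∀ {s η t} x → 4 ≤ η x → Odometer s η t →
                Odometer s (fire x η) (λ z → δ z x + t z)
fire-odometer {s} {η} {t} x 4≤ηx odometer y = begin
  fire x η y + (δ y x + t y) * 4           ≡⟨ cong (fire x η y +_) (*-distribʳ-+ 4 (δ y x) (t y)) ⟩
  fire x η y + (δ y x * 4 + t y * 4)       ≡⟨ +-assoc (fire x η y) _ _ ⟨
  fire x η y + δ y x * 4 + t y * 4         ≡⟨ cong (_+ t y * 4) (fire-conserves x η 4≤ηx y) ⟩
  η y + adjacent x y + t y * 4             ≡⟨ regroup (η y) (adjacent x y) (t y * 4) ⟩
  adjacent x y + (η y + t y * 4)           ≡⟨ cong (adjacent x y +_) (odometer y) ⟩
  adjacent x y + (s y + inflow t′ y)       ≡⟨ x∙yz≈y∙xz (adjacent x y) (s y) (inflow t′ y) ⟩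
  s y + (adjacent x y + inflow t′ y)       ≡⟨ cong (s y +_) (inflow-topple x t y) ⟨
  s y + inflow (λ z _ → δ z x + t z) y     ∎
  where
  open ≡-Reasoning
  t′ = λ z (_ : Dir) → t z
  regroup : ∀ a b c → a + b + c ≡ b + (a + c)
  regroup = solve-∀

module _ {s σ} (tally : RotorTally s σ) where
  open RotorTally tally

  Dominated : (Site → ℕ) → Set
  Dominated t = ∀ y d → t y ≤ emissions y d

  grains≤visits : ∀ {η t} → Odometer s η t → Dominated t → ∀ y → η y + t y * 4 ≤ visits y
  grains≤visits {η} {t} odometer dominated y = begin
    η y + t y * 4                 ≡⟨ odometer y ⟩
    s y + inflow (λ z _ → t z) y  ≤⟨ +-monoʳ-≤ (s y) (inflow-mono-≤ dominated y) ⟩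
    s y + inflow emissions y      ≡⟨ conserved y ⟨
    visits y                      ∎
    where open ≤-Reasoning

  fire-dominated : ∀ {η t} x → 5 ≤ η x → Odometer s η t → Dominated t →
                   Dominated (λ z → δ z x + t z)
  fire-dominated {η} {t} x 5≤ηx odometer dominated y d with y ≟ₛ x
  ... | no _     = dominated y d
  ... | yes refl = s≤s⁻¹ (*-cancelʳ-< 4 (suc (t x)) (suc (emissions x d)) (begin-strict
    suc (t x) * 4            <⟨ +-monoˡ-≤ (t x * 4) 5≤ηx ⟩
    η x + t x * 4            ≤⟨ grains≤visits odometer dominated x ⟩
    visits x                 ≤⟨ visits≤emissions (consistent x) d ⟩
    suc (emissions x d) * 4  ∎))
    where open ≤-Reasoning

  topplings-dominated : ∀ {η η′ t} → Star Topple η η′ → Odometer s η t → Dominated t →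
                        ∃ λ t′ → Odometer s η′ t′ × Dominated t′
  topplings-dominated ε odometer dominated = _ , odometer , dominated
  topplings-dominated (topple η x 5≤ηx ◅ topplings) odometer dominated =
    topplings-dominated topplings
      (fire-odometer {s} x (<⇒≤ 5≤ηx) odometer) (fire-dominated x 5≤ηx odometer dominated)

  grain⇒occupied : ∀ {η} → Star Topple s η → ∀ x → 1 ≤ η x → Occupied σ x
  grain⇒occupied {η} topplings x 1≤ηx
    with t , odometer , dominated ← topplings-dominated topplings (λ _ → refl) (λ _ _ → z≤n)
    = visited⇒occupied (consistent x)
        (≤-trans 1≤ηx (≤-trans (m≤m+n (η x) (t x * 4)) (grains≤visits odometer dominated x)))

mainTheorem6 : ∀ (n : ℕ) (σ : RotorState) (η : Config) → Aggregation n σ → Star Topple (initial n) η → Stable η → ∀ (x : Site) → 1 ≤ η x → Occupied σ x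
mainTheorem6 n σ η aggregation topplings _ =
  grain⇒occupied (aggregation-tally aggregation) topplings
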